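{- For $L\ge0$ let $P_L(x)=\sum_{0\le n<F_{L+3}}(-1)^{s_F(n)}x^n$. Then for every $L\ge2$, \[ P_L(x)=P_{L-1}(x)-x^{F_{L+2}}P_{L-2}(x), \] with $P_0(x)=1-x$ and $P_1(x)=1-x-x^2$. Setting $a_L=P_L(1)$, one has $a_L=a_{L-1}-a_{L-2}$ with $a_0=0$, $a_1=-1$, so $(a_L)_{L\ge0}$ is periodic with period $6$ and $P_L(1)=0$ if and only if $3\mid L$. Equivalently, for every $r\ge0$, on the interval $[0,F_{3r+3})$ the sets $\{n:s_F(n)\equiv0\pmod 2\}$ and $\{n:s_F(n)\equiv1\pmod2\}$ have the same cardinality.
   Context: $F_k$ denotes the Fibonacci numbers with $F_1=F_2=1$, $F_{k+1}=F_k+F_{k-1}$ (so $F_2=1,F_3=2,F_4=3,\dots$). $s_F(n)$ is the number of $1$'s (digit sum) in the Zeckendorf representation of $n$, i.e. its unique representation as a sum of non-consecutive Fibonacci numbers $F_k$ with $k\ge2$. -}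

module Defs where

open import Data.Nat using (ℕ; zero; suc; _+_; _∸_; _≤ᵇ_)
open import Data.Bool using (if_then_else_)
open import Data.List using (List; []; _∷_; length; map; upTo; foldr)
open import Data.Integer using (ℤ; -1ℤ; _^_) renaming (_-_ to _-ℤ_; _+_ to _+ℤ_)
import Data.Integer as ℤ

-- Fibonacci numbers: fib 0 = 0, fib 1 = 1, fib (k+2) = fib (k+1) + fib k
-- (so fib 1 = fib 2 = 1, fib 3 = 2, ... as in the paper).
fib : ℕ → ℕ
fib zero = zero
fib (suc zero) = suc zero
fib (suc (suc k)) = fib (suc k) + fib k

largestFibIdx : ℕ → ℕ → ℕ
largestFibIdx n zero = zero
largestFibIdx n (suc k) = if fib (suc k) ≤ᵇ n then suc k else largestFibIdx n k

-- Zeckendorf representation of n (list of indices k ≥ 2, decreasing,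
-- non-consecutive, with the fib k summing to n), computed by the greedy
-- algorithm: repeatedly subtract the largest Fibonacci number ≤ n.
-- The fuel argument is only for termination; fuel n suffices.
zeckFuel : ℕ → ℕ → List ℕ
zeckFuel zero n = []
zeckFuel (suc f) zero = []
zeckFuel (suc f) (suc m) =
  let k = largestFibIdx (suc m) (suc m + 2) in k ∷ zeckFuel f (suc m ∸ fib k)

zeckendorf : ℕ → List ℕ
zeckendorf n = zeckFuel n n

sF : ℕ → ℕ
sF n = length (zeckendorf n)

-- Polynomials with integer coefficients as coefficient lists
-- (constant term first); two polynomials are equal iff all their
-- coefficients agree.
coeff : List ℤ → ℕ → ℤ
coeff [] n = ℤ.0ℤ
coeff (c ∷ cs) zero = c
coeff (c ∷ cs) (suc n) = coeff cs n

-- coefficient n of x^m * p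
coeffShift : ℕ → List ℤ → ℕ → ℤ
coeffShift m p n = if m ≤ᵇ n then coeff p (n ∸ m) else ℤ.0ℤ

evalAt1 : List ℤ → ℤ
evalAt1 p = foldr _+ℤ_ ℤ.0ℤ p

P : ℕ → List ℤ
P L = map (λ n → -1ℤ ^ sF n) (upTo (fib (L + 3)))

a : ℕ → ℤ
a L = evalAt1 (P L)

-- For F_{L+4} ≤ n < F_{L+5} the greedy Zeckendorf expansion of n is F_{L+4} followed by the
-- expansion of n − F_{L+4} < F_{L+3}, so s_F(n) = 1 + s_F(n − F_{L+4}). Hence the coefficient
-- list of P_{L+2} is that of P_{L+1} followed by the negated coefficients of P_L, which gives the
-- polynomial recurrence and, at x = 1, a_{L+2} = a_{L+1} − a_L, whence a_{L+3} = −a_L.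
-- Finally a_L = P_L(1) is the number of n < F_{L+3} with s_F(n) even minus the number with
-- s_F(n) odd.
module Submission where

open import Defs
open import Data.Bool using (true; false)
open import Data.Empty using (⊥-elim)
open import Data.Integer using (ℤ; 0ℤ; 1ℤ; -1ℤ; +_; -_; _-_)
import Data.Integer as ℤ
import Data.Integer.Properties as ℤ
open import Data.Integer.Tactic.RingSolver using (solve-∀)
open import Data.List using (List; []; _∷_; _++_; length; map; filter; applyUpTo; upTo)
open import Data.List.Properties using (length-map; length-upTo; map-upTo; map-applyUpTo)
open import Data.Nat using (ℕ; zero; suc; _+_; _*_; _∸_; _%_; _≤_; _<_; _≤′_; ≤′-refl; ≤′-step; _≤ᵇ_; z≤n; s≤s)
open import Data.Nat.Divisibility using (_∣_; divides; ∣⇒≤; ∣-refl; ∣m∣n⇒∣m+n; ∣m+n∣m⇒∣n)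
open import Data.Nat.Properties
open import Data.Product using (_×_; _,_)
open import Data.Sum using (_⊎_; inj₁; inj₂)
open import Function using (_∘_)
open import Function.Bundles using (_⇔_; mk⇔; Equivalence)
open import Relation.Nullary.Reflects using (ofʸ; ofⁿ)
open import Relation.Binary.PropositionalEquality

fib-positive : ∀ {k} → 0 < k → 0 < fib k
fib-positive {suc zero} _ = s≤s z≤n
fib-positive {suc (suc k)} _ = ≤-trans (fib-positive {suc k} (s≤s z≤n)) (m≤m+n (fib (suc k)) (fib k))

fib-≤-suc : ∀ k → fib k ≤ fib (suc k)
fib-≤-suc zero = z≤n
fib-≤-suc (suc k) = m≤m+n (fib (suc k)) (fib k)

fib-mono′ : ∀ {i j} → i ≤′ j → fib i ≤ fib j
fib-mono′ ≤′-refl = ≤-refl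
fib-mono′ {j = suc j} (≤′-step i≤′j) = ≤-trans (fib-mono′ i≤′j) (fib-≤-suc j)

fib-mono : ∀ {i j} → i ≤ j → fib i ≤ fib j
fib-mono = fib-mono′ ∘ ≤⇒≤′

n≤1+fib[n] : ∀ j → j ≤ suc (fib j)
n≤1+fib[n] zero = z≤n
n≤1+fib[n] (suc zero) = s≤s z≤n
n≤1+fib[n] (suc (suc zero)) = ≤-refl
n≤1+fib[n] (suc (suc (suc k))) =
  subst (_≤ suc (fib (suc (suc (suc k))))) (cong (suc ∘ suc) (+-comm k 1))
        (+-mono-≤ (n≤1+fib[n] (suc (suc k))) (fib-positive {suc k} (s≤s z≤n)))

largestFibIdx-≡ : ∀ {n j} K → j ≤ K → fib j ≤ n → n < fib (suc j) → largestFibIdx n K ≡ j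
largestFibIdx-≡ zero z≤n _ _ = refl
largestFibIdx-≡ {n} {j} (suc k) j≤1+k fj≤n n<fj+1
  with fib (suc k) ≤ᵇ n | ≤ᵇ-reflects-≤ (fib (suc k)) n | m≤n⇒m<n∨m≡n j≤1+k
... | true  | _ | inj₂ refl = refl
... | true  | ofʸ fk+1≤n | inj₁ (s≤s j≤k) = ⊥-elim (<⇒≱ n<fj+1 (≤-trans (fib-mono (s≤s j≤k)) fk+1≤n))
... | false | ofⁿ fk+1≰n | inj₂ refl = ⊥-elim (fk+1≰n fj≤n)
... | false | _ | inj₁ (s≤s j≤k) = largestFibIdx-≡ k j≤k fj≤n n<fj+1

largestFibIdx-positive : ∀ {n} K → 0 < n → 0 < largestFibIdx n (suc K)
largestFibIdx-positive {n} K 0<n with fib (suc K) ≤ᵇ n | ≤ᵇ-reflects-≤ (fib (suc K)) n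
... | true | _ = s≤s z≤n
... | false | ofⁿ fK+1≰n with K
...   | zero = ⊥-elim (fK+1≰n 0<n)
...   | suc K′ = largestFibIdx-positive K′ 0<n

zeckFuel-fuel-irrelevant : ∀ {f g} n → n ≤ f → n ≤ g → zeckFuel f n ≡ zeckFuel g n
zeckFuel-fuel-irrelevant {zero} {zero} zero _ _ = refl
zeckFuel-fuel-irrelevant {zero} {suc g} zero _ _ = refl
zeckFuel-fuel-irrelevant {suc f} {zero} zero _ _ = refl
zeckFuel-fuel-irrelevant {suc f} {suc g} zero _ _ = refl
zeckFuel-fuel-irrelevant {suc f} {suc g} (suc m) (s≤s m≤f) (s≤s m≤g) =
  cong (k ∷_) (zeckFuel-fuel-irrelevant (suc m ∸ fib k) (≤-trans rest≤m m≤f) (≤-trans rest≤m m≤g))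
  where
  k = largestFibIdx (suc m) (suc m + 2)
  rest≤m : suc m ∸ fib k ≤ m
  rest≤m = ∸-monoʳ-≤ (suc m) (fib-positive (largestFibIdx-positive (m + 2) (s≤s z≤n)))

sF-greedy : ∀ {j n} → fib (suc j) ≤ n → n < fib (suc (suc j)) → sF n ≡ suc (sF (n ∸ fib (suc j)))
sF-greedy {j} {zero} fj≤0 _ = ⊥-elim (<⇒≱ (fib-positive {suc j} (s≤s z≤n)) fj≤0)
sF-greedy {j} {suc m} fj≤n n<fj+1 = begin
  sF (suc m)
    ≡⟨⟩
  suc (length (zeckFuel m (suc m ∸ fib (largestFibIdx (suc m) (suc m + 2)))))
    ≡⟨ cong (λ k → suc (length (zeckFuel m (suc m ∸ fib k)))) greedy-index ⟩
  suc (length (zeckFuel m (suc m ∸ fib (suc j))))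
    ≡⟨ cong (suc ∘ length) (zeckFuel-fuel-irrelevant (suc m ∸ fib (suc j)) rest≤m ≤-refl) ⟩
  suc (sF (suc m ∸ fib (suc j)))  ∎
  where
  open ≡-Reasoning
  j≤bound : suc j ≤ suc m + 2
  j≤bound = ≤-Reasoning.begin
    suc j              ≤-Reasoning.≤⟨ n≤1+fib[n] (suc j) ⟩
    suc (fib (suc j))  ≤-Reasoning.≤⟨ s≤s fj≤n ⟩
    suc (suc m)        ≤-Reasoning.≤⟨ n≤1+n (suc (suc m)) ⟩
    2 + suc m          ≤-Reasoning.≡⟨ +-comm 2 (suc m) ⟩
    suc m + 2          ≤-Reasoning.∎
  greedy-index : largestFibIdx (suc m) (suc m + 2) ≡ suc j
  greedy-index = largestFibIdx-≡ (suc m + 2) j≤bound fj≤n n<fj+1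
  rest≤m : suc m ∸ fib (suc j) ≤ m
  rest≤m = ∸-monoʳ-≤ (suc m) (fib-positive {suc j} (s≤s z≤n))

sF-fib+ : ∀ j {i} → i < fib j → sF (fib (suc j) + i) ≡ suc (sF i)
sF-fib+ (suc k) {i} i<fk+1 = begin
  sF (F + i)            ≡⟨ sF-greedy {suc k} (m≤m+n F i) (+-monoʳ-< F i<fk+1) ⟩
  suc (sF (F + i ∸ F))  ≡⟨ cong (suc ∘ sF) (m+n∸m≡n F i) ⟩
  suc (sF i)            ∎
  where
  open ≡-Reasoning
  F = fib (suc (suc k))

sign : ℕ → ℤ
sign n = -1ℤ ℤ.^ sF n

sign-fib+ : ∀ j {i} → i < fib j → sign (fib (suc j) + i) ≡ - sign i
sign-fib+ j {i} i<fj = trans (cong (-1ℤ ℤ.^_) (sF-fib+ j i<fj)) (ℤ.-1*i≡-i (sign i))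

applyUpTo-+ : ∀ {A : Set} (f : ℕ → A) m n → applyUpTo f (m + n) ≡ applyUpTo f m ++ applyUpTo (λ i → f (m + i)) n
applyUpTo-+ f zero n = refl
applyUpTo-+ f (suc m) n = cong (f 0 ∷_) (applyUpTo-+ (f ∘ suc) m n)

applyUpTo-cong : ∀ {A : Set} {f g : ℕ → A} n → (∀ {i} → i < n → f i ≡ g i) → applyUpTo f n ≡ applyUpTo g n
applyUpTo-cong zero _ = refl
applyUpTo-cong (suc n) f≗g = cong₂ _∷_ (f≗g (s≤s z≤n)) (applyUpTo-cong n (f≗g ∘ s≤s))

P-rec : ∀ L → P (suc (suc L)) ≡ P (suc L) ++ map -_ (P L)
P-rec L = begin
  map sign (upTo (A + B))                    ≡⟨ map-upTo sign (A + B) ⟩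
  applyUpTo sign (A + B)                     ≡⟨ applyUpTo-+ sign A B ⟩
  applyUpTo sign A ++ applyUpTo (λ i → sign (A + i)) B
    ≡⟨ cong₂ _++_ (sym (map-upTo sign A)) (applyUpTo-cong B (sign-fib+ (L + 3))) ⟩
  P (suc L) ++ applyUpTo (-_ ∘ sign) B       ≡⟨ cong (P (suc L) ++_) (sym (map-applyUpTo sign -_ B)) ⟩
  P (suc L) ++ map -_ (applyUpTo sign B)     ≡⟨ cong (λ xs → P (suc L) ++ map -_ xs) (sym (map-upTo sign B)) ⟩
  P (suc L) ++ map -_ (P L)                  ∎
  where
  open ≡-Reasoning
  A = fib (suc (L + 3))
  B = fib (L + 3)

length-P : ∀ L → length (P L) ≡ fib (L + 3)
length-P L = trans (length-map sign (upTo (fib (L + 3)))) (length-upTo (fib (L + 3)))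

coeffShift-suc : ∀ m p n → coeffShift (suc m) p (suc n) ≡ coeffShift m p n
coeffShift-suc zero p n = refl
coeffShift-suc (suc m) p n = refl

coeff-map-neg : ∀ p n → coeff (map -_ p) n ≡ - coeff p n
coeff-map-neg [] n = refl
coeff-map-neg (c ∷ p) zero = refl
coeff-map-neg (c ∷ p) (suc n) = coeff-map-neg p n

coeff-++-neg : ∀ p q n → coeff (p ++ map -_ q) n ≡ coeff p n - coeffShift (length p) q n
coeff-++-neg [] q n = trans (coeff-map-neg q n) (sym (ℤ.+-identityˡ (- coeff q n)))
coeff-++-neg (c ∷ p) q zero = sym (ℤ.+-identityʳ c)
coeff-++-neg (c ∷ p) q (suc n) =
  trans (coeff-++-neg p q n) (cong (λ s → coeff p n - s) (sym (coeffShift-suc (length p) q n)))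

evalAt1-map-neg : ∀ p → evalAt1 (map -_ p) ≡ - evalAt1 p
evalAt1-map-neg [] = refl
evalAt1-map-neg (c ∷ p) =
  trans (cong (λ s → - c ℤ.+ s) (evalAt1-map-neg p)) (sym (ℤ.neg-distrib-+ c (evalAt1 p)))

evalAt1-++-neg : ∀ p q → evalAt1 (p ++ map -_ q) ≡ evalAt1 p - evalAt1 q
evalAt1-++-neg [] q = trans (evalAt1-map-neg q) (sym (ℤ.+-identityˡ (- evalAt1 q)))
evalAt1-++-neg (c ∷ p) q =
  trans (cong (λ s → c ℤ.+ s) (evalAt1-++-neg p q)) (sym (ℤ.+-assoc c (evalAt1 p) (- evalAt1 q)))

coeff-P-rec : ∀ L n → coeff (P (suc (suc L))) n ≡ coeff (P (suc L)) n - coeffShift (fib (suc (suc L) + 2)) (P L) n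
coeff-P-rec L n = begin
  coeff (P (suc (suc L))) n
    ≡⟨ cong (λ p → coeff p n) (P-rec L) ⟩
  coeff (P (suc L) ++ map -_ (P L)) n
    ≡⟨ coeff-++-neg (P (suc L)) (P L) n ⟩
  coeff (P (suc L)) n - coeffShift (length (P (suc L))) (P L) n
    ≡⟨ cong (λ m → coeff (P (suc L)) n - coeffShift m (P L) n) length≡ ⟩
  coeff (P (suc L)) n - coeffShift (fib (suc (suc L) + 2)) (P L) n  ∎
  where
  open ≡-Reasoning
  length≡ : length (P (suc L)) ≡ fib (suc (suc L) + 2)
  length≡ = trans (length-P (suc L)) (cong (fib ∘ suc) (+-suc L 2))

a-rec : ∀ L → a (suc (suc L)) ≡ a (suc L) - a L
a-rec L = trans (cong evalAt1 (P-rec L)) (evalAt1-++-neg (P (suc L)) (P L))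

a-antiperiodic : ∀ L → a (3 + L) ≡ - a L
a-antiperiodic L = begin
  a (3 + L)                    ≡⟨ a-rec (suc L) ⟩
  a (2 + L) - a (suc L)        ≡⟨ cong (λ x → x - a (suc L)) (a-rec L) ⟩
  a (suc L) - a L - a (suc L)  ≡⟨ x-y-x≡-y (a (suc L)) (a L) ⟩
  - a L                        ∎
  where
  open ≡-Reasoning
  x-y-x≡-y : ∀ x y → x - y - x ≡ - y
  x-y-x≡-y = solve-∀

a-periodic : ∀ L → a (L + 6) ≡ a L
a-periodic L = begin
  a (L + 6)      ≡⟨ cong a (+-comm L 6) ⟩
  a (3 + 3 + L)  ≡⟨ a-antiperiodic (3 + L) ⟩
  - a (3 + L)    ≡⟨ cong -_ (a-antiperiodic L) ⟩
  - - a L        ≡⟨ ℤ.neg-involutive (a L) ⟩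
  a L            ∎
  where open ≡-Reasoning

a≡0⇔3∣ : ∀ L → (a L ≡ 0ℤ) ⇔ (3 ∣ L)
a≡0⇔3∣ 0 = mk⇔ (λ _ → divides 0 refl) (λ _ → refl)
a≡0⇔3∣ 1 = mk⇔ (λ ()) (λ 3∣1 → ⊥-elim (<⇒≱ (s≤s (s≤s z≤n)) (∣⇒≤ 3∣1)))
a≡0⇔3∣ 2 = mk⇔ (λ ()) (λ 3∣2 → ⊥-elim (<⇒≱ (s≤s (s≤s (s≤s z≤n))) (∣⇒≤ 3∣2)))
a≡0⇔3∣ (suc (suc (suc L))) = mk⇔
  (λ a≡0 → ∣m∣n⇒∣m+n ∣-refl (to (ℤ.neg-injective (trans (sym (a-antiperiodic L)) a≡0))))
  (λ 3∣3+L → trans (a-antiperiodic L) (cong -_ (from (∣m+n∣m⇒∣n 3∣3+L ∣-refl))))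
  where open Equivalence (a≡0⇔3∣ L)

-1^[2+n]≡-1^n : ∀ n → -1ℤ ℤ.^ (2 + n) ≡ -1ℤ ℤ.^ n
-1^[2+n]≡-1^n n = trans (ℤ.^-distribˡ-+-* -1ℤ 2 n) (ℤ.*-identityˡ (-1ℤ ℤ.^ n))

-1^-parity : ∀ s → (s % 2 ≡ 0 × -1ℤ ℤ.^ s ≡ 1ℤ) ⊎ (s % 2 ≡ 1 × -1ℤ ℤ.^ s ≡ -1ℤ)
-1^-parity 0 = inj₁ (refl , refl)
-1^-parity 1 = inj₂ (refl , refl)
-1^-parity (suc (suc s)) rewrite -1^[2+n]≡-1^n s = -1^-parity s

1+[x-y]≡[1+x]-y : ∀ x y → 1ℤ ℤ.+ (x - y) ≡ (1ℤ ℤ.+ x) - y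
1+[x-y]≡[1+x]-y = solve-∀

-1+[x-y]≡x-[1+y] : ∀ x y → -1ℤ ℤ.+ (x - y) ≡ x - (1ℤ ℤ.+ y)
-1+[x-y]≡x-[1+y] = solve-∀

#sF-even : List ℕ → ℕ
#sF-even ns = length (filter (λ n → sF n % 2 ≟ 0) ns)

#sF-odd : List ℕ → ℕ
#sF-odd ns = length (filter (λ n → sF n % 2 ≟ 1) ns)

evalAt1-map-sign : ∀ ns → evalAt1 (map sign ns) ≡ + #sF-even ns - + #sF-odd ns
evalAt1-map-sign [] = refl
evalAt1-map-sign (n ∷ ns) with sF n % 2 | -1^-parity (sF n)
... | _ | inj₁ (refl , sign≡1) =
  trans (cong₂ ℤ._+_ sign≡1 (evalAt1-map-sign ns)) (1+[x-y]≡[1+x]-y (+ #sF-even ns) (+ #sF-odd ns))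
... | _ | inj₂ (refl , sign≡-1) =
  trans (cong₂ ℤ._+_ sign≡-1 (evalAt1-map-sign ns)) (-1+[x-y]≡x-[1+y] (+ #sF-even ns) (+ #sF-odd ns))

sF-parity-balanced : ∀ r → #sF-even (upTo (fib (3 * r + 3))) ≡ #sF-odd (upTo (fib (3 * r + 3)))
sF-parity-balanced r =
  ℤ.+-injective (ℤ.i-j≡0⇒i≡j _ _ (trans (sym (evalAt1-map-sign (upTo (fib (3 * r + 3))))) a[3r]≡0))
  where
  a[3r]≡0 : a (3 * r) ≡ 0ℤ
  a[3r]≡0 = Equivalence.from (a≡0⇔3∣ (3 * r)) (divides r (*-comm 3 r))

proposition62 : ((L n : ℕ) → coeff (P (suc (suc L))) n ≡ coeff (P (suc L)) n - coeffShift (fib (suc (suc L) + 2)) (P L) n)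
    × ((n : ℕ) → coeff (P 0) n ≡ coeff (1ℤ ∷ -1ℤ ∷ []) n)
    × ((n : ℕ) → coeff (P 1) n ≡ coeff (1ℤ ∷ -1ℤ ∷ -1ℤ ∷ []) n)
    × ((L : ℕ) → a (suc (suc L)) ≡ a (suc L) - a L)
    × (a 0 ≡ 0ℤ)
    × (a 1 ≡ -1ℤ)
    × ((L : ℕ) → a (L + 6) ≡ a L)
    × ((L : ℕ) → (evalAt1 (P L) ≡ 0ℤ) ⇔ (3 ∣ L))
    × ((r : ℕ) → length (filter (λ n → sF n % 2 ≟ 0) (upTo (fib (3 * r + 3))))
                   ≡ length (filter (λ n → sF n % 2 ≟ 1) (upTo (fib (3 * r + 3)))))
proposition62 =
  coeff-P-rec ,
  (λ { 0 → refl ; 1 → refl ; (suc (suc n)) → refl }) ,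
  (λ { 0 → refl ; 1 → refl ; 2 → refl ; (suc (suc (suc n))) → refl }) ,
  a-rec , refl , refl , a-periodic , a≡0⇔3∣ , sF-parity-balanced
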